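{- Let $d$ be either $0$ or a positive square-free integer, $K=\mathbb{Q}(\sqrt{ -d})$, $R$ the ring of integers of $K$, and $n\geq1$. (a) For any such $d$, $\alpha(\Gamma_{1,n})=2n$. (b) If $d\neq1,3$, $\alpha(\Gamma^{un}_{2,n})=2n$. (c) If $d=1$, $\alpha(\Gamma^{un}_{2,n})=4n+1$. (d) If $d=3$, $\alpha(\Gamma^{un}_{2,n})=6n$.
   Context: $\alpha(\cdot)$ denotes the independence number of a graph. The zero-divisor graph $\Gamma(M_2(R))$ is the directed graph whose vertices are the nonzero (left or right) zero-divisors of $M_2(R)$, with an edge $v_1\to v_2$ between distinct vertices iff $v_1v_2=0$. For an integer $N\geq1$ and $t\in R$, let $S_{tc,1,t,N}=\{\lambda\begin{bmatrix}1&t\\t^2&t^3\end{bmatrix}:\lambda\in\mathbb{Z},\,1\leq|\lambda|\leq N\}$ and $S_{tc,2,N}=\{\begin{bmatrix}0&0\\0&\lambda\end{bmatrix}:\lambda\in\mathbb{Z},\,1\leq|\lambda|\leq N\}$. Let $\Gamma_{1,N}$ be the induced subgraph of $\Gamma(M_2(R))$ on $S_{tc,1,0,N}\cup S_{tc,2,N}$, regarded as an undirected graph. Let $U=\{\pm1\}$ if $d\neq1,3$, $U=\{\pm1,\pm i\}$ if $d=1$ ($i=\sqrt{ -1}$), $U=\{\pm1,\pm\omega,\pm\omega^2\}$ if $d=3$ ($\omega$ a primitive third root of unity); let $\Gamma_{2,N}$ be the induced subgraph of $\Gamma(M_2(R))$ on $\bigcup_{j\in U}S_{tc,1,j,N}$,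 and $\Gamma^{un}_{2,N}$ its underlying undirected graph (distinct $v_1,v_2$ adjacent iff $v_1v_2=0$ or $v_2v_1=0$). -}

module Defs where

open import Data.Nat as ℕ using (ℕ; zero; suc; _≡ᵇ_)
open import Data.Nat.DivMod using (_%_; _/_)
open import Data.Nat.Divisibility using (_∣_)
open import Data.Integer as ℤ using (ℤ; +_; -_; _+_; _*_; ∣_∣)
open import Data.Product using (Σ; ∃; _×_; _,_)
open import Data.Sum using (_⊎_)
open import Data.Bool using (if_then_else_)
open import Data.List using (List; []; _∷_; length)
open import Data.List.Relation.Unary.All using (All)
open import Data.List.Relation.Unary.AllPairs using (AllPairs)
open import Data.List.Membership.Propositional using (_∈_)
open import Relation.Binary.PropositionalEquality using (_≡_; _≢_)
open import Relation.Nullary using (¬_)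

SquareFree : ℕ → Set
SquareFree d = ∀ m → (m ℕ.* m) ∣ d → m ≡ 1

Admissible : ℕ → Set
Admissible d = d ≡ 0 ⊎ (1 ℕ.≤ d × SquareFree d)

-- The ring of integers R of K = ℚ(√-d).
--  * d = 0 : K = ℚ, R = ℤ.
--  * d ≥ 1 square-free : R = ℤ[θ] with ℤ-basis {1, θ}, where
--      θ = √-d            if d ≢ 3 (mod 4)   (θ² = -d)
--      θ = (1 + √-d)/2    if d ≡ 3 (mod 4)   (θ² = θ - (1+d)/4)
--    An element (a , b) represents a + bθ.

-- θ² = θ²-const d + θ²-lin d · θ
θ²-const : ℕ → ℤ
θ²-const d = if d % 4 ≡ᵇ 3 then - (+ ((d ℕ.+ 1) / 4)) else - (+ d)

θ²-lin : ℕ → ℤ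
θ²-lin d = if d % 4 ≡ᵇ 3 then + 1 else + 0

𝓞 : ℕ → Set
𝓞 zero = ℤ
𝓞 (suc d) = ℤ × ℤ

ι : ∀ d → ℤ → 𝓞 d
ι zero x = x
ι (suc d) x = (x , + 0)

0ᴿ : ∀ d → 𝓞 d
0ᴿ d = ι d (+ 0)

addᴿ : ∀ d → 𝓞 d → 𝓞 d → 𝓞 d
addᴿ zero x y = x + y
addᴿ (suc d) (a , b) (c , e) = (a + c , b + e)

mulᴿ : ∀ d → 𝓞 d → 𝓞 d → 𝓞 d
mulᴿ zero x y = x * y
mulᴿ (suc d) (a , b) (c , e) =
  ( a * c + b * e * θ²-const (suc d)
  , a * e + b * c + b * e * θ²-lin (suc d) )

record M₂ (d : ℕ) : Set where
  constructor mat
  field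
    m₁₁ m₁₂ m₂₁ m₂₂ : 𝓞 d

open M₂ public

0ᴹ : ∀ d → M₂ d
0ᴹ d = mat (0ᴿ d) (0ᴿ d) (0ᴿ d) (0ᴿ d)

mulᴹ : ∀ d → M₂ d → M₂ d → M₂ d
mulᴹ d (mat a b c e) (mat a' b' c' e') =
  mat (addᴿ d (mulᴿ d a a') (mulᴿ d b c'))
      (addᴿ d (mulᴿ d a b') (mulᴿ d b e'))
      (addᴿ d (mulᴿ d c a') (mulᴿ d e c'))
      (addᴿ d (mulᴿ d c b') (mulᴿ d e e'))

scalᴹ : ∀ d → 𝓞 d → M₂ d → M₂ d
scalᴹ d s (mat a b c e) = mat (mulᴿ d s a) (mulᴿ d s b) (mulᴿ d s c) (mulᴿ d s e)

Aₜ : ∀ d → 𝓞 d → M₂ d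
Aₜ d t = mat (ι d (+ 1)) t (mulᴿ d t t) (mulᴿ d (mulᴿ d t t) t)

S-tc1 : ∀ d → 𝓞 d → ℕ → M₂ d → Set
S-tc1 d t N v = Σ ℤ (λ l → 1 ℕ.≤ ∣ l ∣ × ∣ l ∣ ℕ.≤ N × v ≡ scalᴹ d (ι d l) (Aₜ d t))

S-tc2 : ∀ d → ℕ → M₂ d → Set
S-tc2 d N v = Σ ℤ (λ l → 1 ℕ.≤ ∣ l ∣ × ∣ l ∣ ℕ.≤ N × v ≡ mat (0ᴿ d) (0ᴿ d) (0ᴿ d) (ι d l))

-- d = 1 : θ = i = (0 , 1)
-- d = 3 : θ = (1+√-3)/2, ω = θ - 1 = (-1 , 1), ω² = -θ = (0 , -1)
U : ∀ d → List (𝓞 d)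
U 1 = (+ 1 , + 0) ∷ (- + 1 , + 0) ∷ (+ 0 , + 1) ∷ (+ 0 , - + 1) ∷ []
U 3 = (+ 1 , + 0) ∷ (- + 1 , + 0)
    ∷ (- + 1 , + 1) ∷ (+ 1 , - + 1)
    ∷ (+ 0 , - + 1) ∷ (+ 0 , + 1) ∷ []
U d = ι d (+ 1) ∷ ι d (- + 1) ∷ []

Adjᵘⁿ : ∀ d → M₂ d → M₂ d → Set
Adjᵘⁿ d v w = v ≢ w × (mulᴹ d v w ≡ 0ᴹ d ⊎ mulᴹ d w v ≡ 0ᴹ d)

record IsIndependentSet {A : Set} (V : A → Set) (Adj : A → A → Set) (xs : List A) : Set where
  field
    members  : All V xs
    distinct : AllPairs _≢_ xs
    indep    : AllPairs (λ v w → ¬ Adj v w) xs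

IndependenceNumber : {A : Set} (V : A → Set) (Adj : A → A → Set) → ℕ → Set
IndependenceNumber {A} V Adj m =
  Σ (List A) (λ xs → IsIndependentSet V Adj xs × length xs ≡ m)
  × (∀ xs → IsIndependentSet V Adj xs → length xs ℕ.≤ m)

V-Γ₁ : ∀ d → ℕ → M₂ d → Set
V-Γ₁ d N v = S-tc1 d (0ᴿ d) N v ⊎ S-tc2 d N v

V-Γ₂ : ∀ d → ℕ → M₂ d → Set
V-Γ₂ d N v = Σ (𝓞 d) (λ j → j ∈ U d × S-tc1 d j N v)

-- Every vertex is a multiple l·Aⱼ with 1 ≤ |l| ≤ n (or l·E₂₂ in Γ₁), and
--   Aⱼ Aⱼ' = (1 + j j'²) [[1, j'], [j², j² j']],
-- so all multiples of units j for which 1 + j j'² never vanishes are pairwise non-adjacent.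
-- For the upper bound the vertices are covered by cliques, each of which an independent set meets
-- at most once (pigeonhole): l·Aⱼ and l·Aⱼ' share a clique when Aⱼ Aⱼ' = 0 or Aⱼ' Aⱼ = 0, and all
-- multiples of Aⱼ form one clique when Aⱼ² = 0. For a cube root of unity u, A₋ᵤ Aᵤ = 0 since
-- 1 - u·u² = 0, so the units ±u pair up: this gives 2n for ±1 and 6n for ±1, ±ω, ±ω², and likewise
-- A₀ E₂₂ = 0 pairs l·A₀ with l·E₂₂ in Γ₁. For d = 1, A₁ A±ᵢ = 0 pairs 1 with i, while A₋₁² = 0 makes
-- the multiples of A₋₁ a single clique, and one of them can be added to the 4n multiples of A±ᵢ.
module Submission where

open import Defs
open import Data.Nat as ℕ using (ℕ; zero; suc; _≤_; _*_; _+_; z≤n; s≤s)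
import Data.Nat.Properties as ℕ
open import Data.Integer as ℤ using (ℤ; +_; -_; ∣_∣; +0; +[1+_]; -[1+_])
import Data.Integer.Properties as ℤ
open import Data.Integer.Tactic.RingSolver using (solve-∀)
open import Data.Fin as Fin using (Fin; zero; suc; fromℕ<; combine; splitAt)
import Data.Fin.Properties as Fin
open import Data.Product using (Σ; _×_; _,_; proj₁; proj₂; uncurry)
import Data.Product.Properties as ×
open import Data.Sum as Sum using (_⊎_; inj₁; inj₂; [_,_]′)
import Data.Sum.Properties as Sum
open import Data.Empty using (⊥-elim)
open import Data.List using (List; []; _∷_; _++_; length; lookup; map; cartesianProduct)
import Data.List.Properties as List
open import Data.List.Membership.Propositional using (_∈_)
open import Data.List.Membership.Propositional.Properties using (∈-lookup)
open import Data.List.Relation.Unary.All as All using (All; []; _∷_)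
import Data.List.Relation.Unary.All.Properties as All
open import Data.List.Relation.Unary.AllPairs as AllPairs using (AllPairs; []; _∷_)
import Data.List.Relation.Unary.AllPairs.Properties as AllPairs
open import Data.List.Relation.Unary.Any using (index; here; there)
open import Data.List.Relation.Unary.Any.Properties using (lookup-index)
open import Data.List.Relation.Unary.Unique.Propositional using (Unique)
import Data.List.Relation.Unary.Unique.Propositional.Properties as Unique
open import Function using (_∘_)
open import Relation.Nullary using (¬_; Dec; yes; no)
open import Relation.Nullary.Decidable using (map′; _×-dec_; _⊎-dec_; _→-dec_; ¬?; from-yes)
open import Relation.Binary.Definitions using (DecidableEquality)
open import Relation.Binary.PropositionalEquality
open import Relation.Binary.PropositionalEquality.Properties using (setoid)

ι-injective : ∀ d {a b} → ι d a ≡ ι d b → a ≡ b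
ι-injective zero    eq   = eq
ι-injective (suc d) refl = refl

mulᴿ-ι-suc : ∀ d l a b → mulᴿ (suc d) (ι (suc d) l) (a , b) ≡ (l ℤ.* a , l ℤ.* b)
mulᴿ-ι-suc d l a b = cong₂ _,_ (ℤ.+-identityʳ (l ℤ.* a)) (trans (ℤ.+-identityʳ _) (ℤ.+-identityʳ _))

mulᴿ-ι-ι : ∀ d a b → mulᴿ d (ι d a) (ι d b) ≡ ι d (a ℤ.* b)
mulᴿ-ι-ι zero    a b = refl
mulᴿ-ι-ι (suc d) a b = trans (mulᴿ-ι-suc d a b +0) (cong (a ℤ.* b ,_) (ℤ.*-zeroʳ a))

mulᴿ-ι-identityʳ : ∀ d l → mulᴿ d (ι d l) (ι d (+ 1)) ≡ ι d l
mulᴿ-ι-identityʳ d l = trans (mulᴿ-ι-ι d l (+ 1)) (cong (ι d) (ℤ.*-identityʳ l))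

mulᴿ-ι-zeroʳ : ∀ d l → mulᴿ d (ι d l) (0ᴿ d) ≡ 0ᴿ d
mulᴿ-ι-zeroʳ d l = trans (mulᴿ-ι-ι d l +0) (cong (ι d) (ℤ.*-zeroʳ l))

*-cancelˡ-≢0 : ∀ l {x y} → l ≢ +0 → l ℤ.* x ≡ l ℤ.* y → x ≡ y
*-cancelˡ-≢0 l l≢0 = ℤ.*-cancelˡ-≡ l _ _ {{ℤ.≢-nonZero l≢0}}

mulᴿ-ι-cancel : ∀ d l {x y} → l ≢ +0 → mulᴿ d (ι d l) x ≡ mulᴿ d (ι d l) y → x ≡ y
mulᴿ-ι-cancel zero    l l≢0 eq = *-cancelˡ-≢0 l l≢0 eq
mulᴿ-ι-cancel (suc d) l {a , b} {a' , b'} l≢0 eq =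
  cong₂ _,_ (*-cancelˡ-≢0 l l≢0 (cong proj₁ eq')) (*-cancelˡ-≢0 l l≢0 (cong proj₂ eq'))
  where eq' = trans (sym (mulᴿ-ι-suc d l a b)) (trans eq (mulᴿ-ι-suc d l a' b'))

mulᴿ-ι≡0⇒l≡0∨x≡0 : ∀ d l x → mulᴿ d (ι d l) x ≡ 0ᴿ d → l ≡ +0 ⊎ x ≡ 0ᴿ d
mulᴿ-ι≡0⇒l≡0∨x≡0 zero    l x eq = ℤ.i*j≡0⇒i≡0∨j≡0 l eq
mulᴿ-ι≡0⇒l≡0∨x≡0 (suc d) l (a , b) eq
  with ℤ.i*j≡0⇒i≡0∨j≡0 l (cong proj₁ eq') | ℤ.i*j≡0⇒i≡0∨j≡0 l (cong proj₂ eq')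
  where eq' = trans (sym (mulᴿ-ι-suc d l a b)) eq
... | inj₁ l≡0  | _         = inj₁ l≡0
... | inj₂ _    | inj₁ l≡0  = inj₁ l≡0
... | inj₂ refl | inj₂ refl = inj₂ refl

mulᴿ-ι-mulᴿ : ∀ d l μ x y →
  mulᴿ d (mulᴿ d (ι d l) x) (mulᴿ d (ι d μ) y) ≡ mulᴿ d (ι d (l ℤ.* μ)) (mulᴿ d x y)
mulᴿ-ι-mulᴿ zero l μ x y = interchange l μ x y
  where
  interchange : ∀ l μ x y → (l ℤ.* x) ℤ.* (μ ℤ.* y) ≡ (l ℤ.* μ) ℤ.* (x ℤ.* y)
  interchange = solve-∀
mulᴿ-ι-mulᴿ (suc d) l μ (a , b) (a' , b') = begin
  mulᴿ (suc d) (mulᴿ (suc d) (ι (suc d) l) (a , b)) (mulᴿ (suc d) (ι (suc d) μ) (a' , b'))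
    ≡⟨ cong₂ (mulᴿ (suc d)) (mulᴿ-ι-suc d l a b) (mulᴿ-ι-suc d μ a' b') ⟩
  mulᴿ (suc d) (l ℤ.* a , l ℤ.* b) (μ ℤ.* a' , μ ℤ.* b')
    ≡⟨ cong₂ _,_ (first l μ a b a' b' _) (second l μ a b a' b' _) ⟩
  (l ℤ.* μ) ℤ.* proj₁ (mulᴿ (suc d) (a , b) (a' , b')) , (l ℤ.* μ) ℤ.* proj₂ (mulᴿ (suc d) (a , b) (a' , b'))
    ≡⟨ sym (mulᴿ-ι-suc d (l ℤ.* μ) _ _) ⟩
  mulᴿ (suc d) (ι (suc d) (l ℤ.* μ)) (mulᴿ (suc d) (a , b) (a' , b')) ∎
  where
  open ≡-Reasoning
  first : ∀ l μ a b a' b' C →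
    (l ℤ.* a) ℤ.* (μ ℤ.* a') ℤ.+ (l ℤ.* b) ℤ.* (μ ℤ.* b') ℤ.* C
    ≡ (l ℤ.* μ) ℤ.* (a ℤ.* a' ℤ.+ b ℤ.* b' ℤ.* C)
  first = solve-∀
  second : ∀ l μ a b a' b' L →
    (l ℤ.* a) ℤ.* (μ ℤ.* b') ℤ.+ (l ℤ.* b) ℤ.* (μ ℤ.* a') ℤ.+ (l ℤ.* b) ℤ.* (μ ℤ.* b') ℤ.* L
    ≡ (l ℤ.* μ) ℤ.* (a ℤ.* b' ℤ.+ b ℤ.* a' ℤ.+ b ℤ.* b' ℤ.* L)
  second = solve-∀

mulᴿ-ι-addᴿ : ∀ d l x y → addᴿ d (mulᴿ d (ι d l) x) (mulᴿ d (ι d l) y) ≡ mulᴿ d (ι d l) (addᴿ d x y)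
mulᴿ-ι-addᴿ zero l x y = sym (ℤ.*-distribˡ-+ l x y)
mulᴿ-ι-addᴿ (suc d) l (a , b) (a' , b') = begin
  addᴿ (suc d) (mulᴿ (suc d) (ι (suc d) l) (a , b)) (mulᴿ (suc d) (ι (suc d) l) (a' , b'))
    ≡⟨ cong₂ (addᴿ (suc d)) (mulᴿ-ι-suc d l a b) (mulᴿ-ι-suc d l a' b') ⟩
  (l ℤ.* a ℤ.+ l ℤ.* a' , l ℤ.* b ℤ.+ l ℤ.* b')
    ≡⟨ cong₂ _,_ (sym (ℤ.*-distribˡ-+ l a a')) (sym (ℤ.*-distribˡ-+ l b b')) ⟩
  (l ℤ.* (a ℤ.+ a') , l ℤ.* (b ℤ.+ b'))
    ≡⟨ sym (mulᴿ-ι-suc d l _ _) ⟩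
  mulᴿ (suc d) (ι (suc d) l) (a ℤ.+ a' , b ℤ.+ b') ∎
  where open ≡-Reasoning

_≟ᴿ_ : ∀ {d} → DecidableEquality (𝓞 d)
_≟ᴿ_ {zero}  = ℤ._≟_
_≟ᴿ_ {suc d} = ×.≡-dec ℤ._≟_ ℤ._≟_

scalᴹ-mulᴹ : ∀ d l μ M N →
  mulᴹ d (scalᴹ d (ι d l) M) (scalᴹ d (ι d μ) N) ≡ scalᴹ d (ι d (l ℤ.* μ)) (mulᴹ d M N)
scalᴹ-mulᴹ d l μ (mat a b c e) (mat a' b' c' e') =
  cong₂ (λ f x → f x) (cong₂ (λ f x → f x) (cong₂ mat (entry a b a' c') (entry a b b' e'))
                                        (entry c e a' c'))
                      (entry c e b' e')
  where
  entry : ∀ x y x' y' →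
    addᴿ d (mulᴿ d (mulᴿ d (ι d l) x) (mulᴿ d (ι d μ) x')) (mulᴿ d (mulᴿ d (ι d l) y) (mulᴿ d (ι d μ) y'))
    ≡ mulᴿ d (ι d (l ℤ.* μ)) (addᴿ d (mulᴿ d x x') (mulᴿ d y y'))
  entry x y x' y' = trans (cong₂ (addᴿ d) (mulᴿ-ι-mulᴿ d l μ x x') (mulᴿ-ι-mulᴿ d l μ y y'))
                          (mulᴿ-ι-addᴿ d (l ℤ.* μ) _ _)

scalᴹ-0ᴹ : ∀ d l → scalᴹ d (ι d l) (0ᴹ d) ≡ 0ᴹ d
scalᴹ-0ᴹ d l rewrite mulᴿ-ι-zeroʳ d l = refl

scalᴹ-zero-product : ∀ d l μ {M N} → mulᴹ d M N ≡ 0ᴹ d →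
  mulᴹ d (scalᴹ d (ι d l) M) (scalᴹ d (ι d μ) N) ≡ 0ᴹ d
scalᴹ-zero-product d l μ {M} {N} MN≡0 = begin
  mulᴹ d (scalᴹ d (ι d l) M) (scalᴹ d (ι d μ) N) ≡⟨ scalᴹ-mulᴹ d l μ M N ⟩
  scalᴹ d (ι d (l ℤ.* μ)) (mulᴹ d M N)           ≡⟨ cong (scalᴹ d (ι d (l ℤ.* μ))) MN≡0 ⟩
  scalᴹ d (ι d (l ℤ.* μ)) (0ᴹ d)                 ≡⟨ scalᴹ-0ᴹ d (l ℤ.* μ) ⟩
  0ᴹ d                                           ∎
  where open ≡-Reasoning

scalᴹ-mulᴹ≢0ᴹ : ∀ d {l μ M N} → l ≢ +0 → μ ≢ +0 → m₁₁ (mulᴹ d M N) ≢ 0ᴿ d →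
  mulᴹ d (scalᴹ d (ι d l) M) (scalᴹ d (ι d μ) N) ≢ 0ᴹ d
scalᴹ-mulᴹ≢0ᴹ d {l} {μ} {M} {N} l≢0 μ≢0 MN₁₁≢0 eq
  with mulᴿ-ι≡0⇒l≡0∨x≡0 d (l ℤ.* μ) _ (cong m₁₁ (trans (sym (scalᴹ-mulᴹ d l μ M N)) eq))
... | inj₂ MN₁₁≡0 = MN₁₁≢0 MN₁₁≡0
... | inj₁ lμ≡0   = [ l≢0 , μ≢0 ]′ (ℤ.i*j≡0⇒i≡0∨j≡0 l lμ≡0)

_≟ᴹ_ : ∀ {d} → DecidableEquality (M₂ d)
mat a b c e ≟ᴹ mat a' b' c' e' =
  map′ (λ { (refl , refl , refl , refl) → refl }) (λ { refl → refl , refl , refl , refl })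
       (a ≟ᴿ a' ×-dec b ≟ᴿ b' ×-dec c ≟ᴿ c' ×-dec e ≟ᴿ e')

zero-product⇒≡⊎Adjᵘⁿ : ∀ d {v w} → mulᴹ d v w ≡ 0ᴹ d ⊎ mulᴹ d w v ≡ 0ᴹ d → v ≡ w ⊎ Adjᵘⁿ d v w
zero-product⇒≡⊎Adjᵘⁿ d {v} {w} vw≡0 with v ≟ᴹ w
... | yes v≡w = inj₁ v≡w
... | no  v≢w = inj₂ (v≢w , vw≡0)

scalᴹ-nonadjacent : ∀ d {l μ M N} → l ≢ +0 → μ ≢ +0 →
  m₁₁ (mulᴹ d M N) ≢ 0ᴿ d → m₁₁ (mulᴹ d N M) ≢ 0ᴿ d →
  ¬ Adjᵘⁿ d (scalᴹ d (ι d l) M) (scalᴹ d (ι d μ) N)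
scalᴹ-nonadjacent d l≢0 μ≢0 MN≢0 NM≢0 (_ , inj₁ eq) = scalᴹ-mulᴹ≢0ᴹ d l≢0 μ≢0 MN≢0 eq
scalᴹ-nonadjacent d l≢0 μ≢0 MN≢0 NM≢0 (_ , inj₂ eq) = scalᴹ-mulᴹ≢0ᴹ d μ≢0 l≢0 NM≢0 eq

scalᴹ-Aₜ-injective : ∀ d {l l' j j'} → l ≢ +0 →
  scalᴹ d (ι d l) (Aₜ d j) ≡ scalᴹ d (ι d l') (Aₜ d j') → l ≡ l' × j ≡ j'
scalᴹ-Aₜ-injective d {l} {l'} l≢0 eq
  with ι-injective d (trans (sym (mulᴿ-ι-identityʳ d l)) (trans (cong m₁₁ eq) (mulᴿ-ι-identityʳ d l')))
... | refl = refl , mulᴿ-ι-cancel d l l≢0 (cong m₁₂ eq)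

Coeff : ℕ → ℤ → Set
Coeff n l = 1 ≤ ∣ l ∣ × ∣ l ∣ ≤ n

Coeff⇒≢0 : ∀ {n l} → Coeff n l → l ≢ +0
Coeff⇒≢0 (() , _) refl

coeffs : ℕ → List ℤ
coeffs zero    = []
coeffs (suc n) = + suc n ∷ -[1+ n ] ∷ coeffs n

length-coeffs : ∀ n → length (coeffs n) ≡ 2 * n
length-coeffs zero    = refl
length-coeffs (suc n) = trans (cong suc (cong suc (length-coeffs n))) (sym (ℕ.*-suc 2 n))

coeffs-Coeff : ∀ n → All (Coeff n) (coeffs n)
coeffs-Coeff zero    = []
coeffs-Coeff (suc n) = (s≤s z≤n , ℕ.≤-refl) ∷ (s≤s z≤n , ℕ.≤-refl)
                     ∷ All.map (λ (1≤l , l≤n) → 1≤l , ℕ.m≤n⇒m≤1+n l≤n) (coeffs-Coeff n)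

coeffs-unique : ∀ n → Unique (coeffs n)
coeffs-unique zero    = []
coeffs-unique (suc n) = ((λ ()) ∷ fresh refl) ∷ fresh refl ∷ coeffs-unique n
  where
  fresh : ∀ {x} → ∣ x ∣ ≡ suc n → All (x ≢_) (coeffs n)
  fresh ∣x∣≡1+n = All.map (λ { (_ , ∣x∣≤n) refl → ℕ.1+n≰n (subst (_≤ n) ∣x∣≡1+n ∣x∣≤n) }) (coeffs-Coeff n)

coeffIndex : ∀ {n} l → Coeff n l → Fin (2 * n)
coeffIndex {n} +[1+ k ] (_ , k<n) = combine {2} {n} zero (fromℕ< k<n)
coeffIndex {n} -[1+ k ] (_ , k<n) = combine {2} {n} (suc zero) (fromℕ< k<n)
coeffIndex +0 (() , _)

coeffIndex-injective : ∀ {n l l'} (c : Coeff n l) (c' : Coeff n l') → coeffIndex l c ≡ coeffIndex l' c' → l ≡ l'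
coeffIndex-injective {n} {+[1+ k ]} {+[1+ k' ]} (_ , k<n) (_ , k'<n) eq =
  cong +[1+_] (Fin.fromℕ<-injective k k' k<n k'<n
    (proj₂ (Fin.combine-injective {2} {n} zero (fromℕ< k<n) zero (fromℕ< k'<n) eq)))
coeffIndex-injective {n} { -[1+ k ]} { -[1+ k' ]} (_ , k<n) (_ , k'<n) eq =
  cong -[1+_] (Fin.fromℕ<-injective k k' k<n k'<n
    (proj₂ (Fin.combine-injective {2} {n} (suc zero) (fromℕ< k<n) (suc zero) (fromℕ< k'<n) eq)))
coeffIndex-injective {n} {+[1+ k ]} { -[1+ k' ]} (_ , k<n) (_ , k'<n) eq
  with () ← proj₁ (Fin.combine-injective {2} {n} zero (fromℕ< k<n) (suc zero) (fromℕ< k'<n) eq)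
coeffIndex-injective {n} { -[1+ k ]} {+[1+ k' ]} (_ , k<n) (_ , k'<n) eq
  with () ← proj₁ (Fin.combine-injective {2} {n} (suc zero) (fromℕ< k<n) zero (fromℕ< k'<n) eq)
coeffIndex-injective {l = +0} (() , _) _ _
coeffIndex-injective {l' = +0} _ (() , _) _

module _ {A : Set} {P : A → Set} {R : A → A → Set} where

  All⇒AllPairs : ∀ {xs} → All P xs → (∀ {x y} → P x → P y → R x y) → AllPairs R xs
  All⇒AllPairs []         f = []
  All⇒AllPairs (px ∷ pxs) f = All.map (f px) pxs ∷ All⇒AllPairs pxs f

  AllPairs-on : ∀ {xs} → All P xs → AllPairs (λ x y → P x → P y → R x y) xs → AllPairs R xs
  AllPairs-on []         []         = []
  AllPairs-on (px ∷ pxs) (rx ∷ rxs) = All.zipWith (λ (py , r) → r px py) (pxs , rx) ∷ AllPairs-on pxs rxs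

AllPairs-lookup : ∀ {A : Set} {R : A → A → Set} {xs} → AllPairs R xs →
  ∀ {i j} → i Fin.< j → R (lookup xs i) (lookup xs j)
AllPairs-lookup (Rx ∷ _)  {zero}  {suc j} _         = All.lookup Rx (∈-lookup j)
AllPairs-lookup (_ ∷ Rxs) {suc i} {suc j} (s≤s i<j) = AllPairs-lookup Rxs i<j

length-cartesianProduct : ∀ {A B : Set} (xs : List A) (ys : List B) →
  length (cartesianProduct xs ys) ≡ length xs * length ys
length-cartesianProduct []       ys = refl
length-cartesianProduct (x ∷ xs) ys = begin
  length (map (x ,_) ys ++ cartesianProduct xs ys)         ≡⟨ List.length-++ (map (x ,_) ys) ⟩
  length (map (x ,_) ys) + length (cartesianProduct xs ys) ≡⟨ cong₂ _+_ (List.length-map (x ,_) ys)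
                                                                       (length-cartesianProduct xs ys) ⟩
  length ys + length xs * length ys                        ∎
  where open ≡-Reasoning

record CliqueCover {A : Set} (V : A → Set) (Adj : A → A → Set) (m : ℕ) : Set where
  field
    class      : ∀ {v} → V v → Fin m
    same-class : ∀ {v w} (p : V v) (q : V w) → class p ≡ class q → v ≡ w ⊎ Adj v w

open CliqueCover
open IsIndependentSet

module _ {A : Set} {V : A → Set} {Adj : A → A → Set} where

  independent≤cover : ∀ {m xs} → CliqueCover V Adj m → IsIndependentSet V Adj xs → length xs ≤ m
  independent≤cover {m} {xs} cover I with m ℕ.<? length xs
  ... | no  m≮len = ℕ.≮⇒≥ m≮len
  ... | yes m<len with i , j , i<j , same ← Fin.pigeonhole m<len (class cover ∘ All.lookup (members I) ∘ ∈-lookup)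
    = ⊥-elim ([ AllPairs-lookup (distinct I) i<j , AllPairs-lookup (indep I) i<j ]′ (same-class cover _ _ same))

  independenceNumber : ∀ {m xs} → IsIndependentSet V Adj xs → length xs ≡ m → CliqueCover V Adj m →
    IndependenceNumber V Adj m
  independenceNumber {xs = xs} I refl cover = (xs , I , refl) , λ _ J → independent≤cover cover J

  IsIndependentSet-mono : ∀ {W : A → Set} → (∀ {v} → V v → W v) →
    ∀ {xs} → IsIndependentSet V Adj xs → IsIndependentSet W Adj xs
  IsIndependentSet-mono V⇒W I = record { members = All.map V⇒W (members I) ; distinct = distinct I ; indep = indep I }

  IsIndependentSet-∷ : ∀ {v xs} → V v → All (λ w → v ≢ w × ¬ Adj v w) xs →
    IsIndependentSet V Adj xs → IsIndependentSet V Adj (v ∷ xs)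
  IsIndependentSet-∷ Vv sep I = record
    { members  = Vv ∷ members I
    ; distinct = All.map proj₁ sep ∷ distinct I
    ; indep    = All.map proj₂ sep ∷ indep I }

vertex : ∀ d → 𝓞 d × ℤ → M₂ d
vertex d (j , l) = scalᴹ d (ι d l) (Aₜ d j)

⋃S-tc1 : ∀ d → ℕ → List (𝓞 d) → M₂ d → Set
⋃S-tc1 d n js v = Σ (𝓞 d) λ j → j ∈ js × S-tc1 d j n v

Apart : ∀ d → 𝓞 d → 𝓞 d → Set
Apart d j j' = m₁₁ (mulᴹ d (Aₜ d j) (Aₜ d j')) ≢ 0ᴿ d

PairwiseApart : ∀ d → List (𝓞 d) → Set
PairwiseApart d js = All (λ j → All (Apart d j) js) js

Separated : ∀ d → 𝓞 d → 𝓞 d → Set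
Separated d k j = k ≢ j × Apart d k j × Apart d j k

Annihilates : ∀ d → 𝓞 d → 𝓞 d → Set
Annihilates d j j' = mulᴹ d (Aₜ d j) (Aₜ d j') ≡ 0ᴹ d

annihilates⇒≡⊎Adjᵘⁿ : ∀ d {j j'} → Annihilates d j j' ⊎ Annihilates d j' j →
  ∀ l l' → vertex d (j , l) ≡ vertex d (j' , l') ⊎ Adjᵘⁿ d (vertex d (j , l)) (vertex d (j' , l'))
annihilates⇒≡⊎Adjᵘⁿ d ann l l' =
  zero-product⇒≡⊎Adjᵘⁿ d (Sum.map (scalᴹ-zero-product d l l') (scalᴹ-zero-product d l' l) ann)

module _ (d n : ℕ) where

  ⋃S-tc1-mono : ∀ {js us} → All (_∈ us) js → ∀ {v} → ⋃S-tc1 d n js v → ⋃S-tc1 d n us v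
  ⋃S-tc1-mono js⊆us (j , j∈js , s) = j , All.lookup js⊆us j∈js , s

  multiples : List (𝓞 d) → List (M₂ d)
  multiples js = map (vertex d) (cartesianProduct js (coeffs n))

  length-multiples : ∀ js → length (multiples js) ≡ length js * (2 * n)
  length-multiples js = begin
    length (multiples js)                   ≡⟨ List.length-map (vertex d) (cartesianProduct js (coeffs n)) ⟩
    length (cartesianProduct js (coeffs n)) ≡⟨ length-cartesianProduct js (coeffs n) ⟩
    length js * length (coeffs n)           ≡⟨ cong (length js *_) (length-coeffs n) ⟩
    length js * (2 * n)                     ∎
    where open ≡-Reasoning

  multiples-independent : ∀ {js} → Unique js → PairwiseApart d js →
    IsIndependentSet (⋃S-tc1 d n js) (Adjᵘⁿ d) (multiples js)
  multiples-independent {js} js-unique js-apart = record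
    { members  = All.map⁺ (All.map (λ { {j , l} (j∈js , 1≤l , l≤n) → j , j∈js , l , 1≤l , l≤n , refl }) indexed)
    ; distinct = AllPairs.map⁺ (AllPairs-on indexed
                   (AllPairs.map (λ x≢y (_ , c) _ eq → x≢y (injective c eq))
                                 (Unique.cartesianProduct⁺ js-unique (coeffs-unique n))))
    ; indep    = AllPairs.map⁺ (All⇒AllPairs indexed λ (j∈ , c) (j'∈ , c') →
                   scalᴹ-nonadjacent d (Coeff⇒≢0 c) (Coeff⇒≢0 c')
                     (All.lookup (All.lookup js-apart j∈) j'∈) (All.lookup (All.lookup js-apart j'∈) j∈))
    }
    where
    Indexed : 𝓞 d × ℤ → Set
    Indexed (j , l) = j ∈ js × Coeff n l

    indexed : All Indexed (cartesianProduct js (coeffs n))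
    indexed = All.cartesianProduct⁺ (setoid _) (setoid _) js (coeffs n) λ j∈ l∈ → j∈ , All.lookup (coeffs-Coeff n) l∈

    injective : ∀ {j l x} → Coeff n l → vertex d (j , l) ≡ vertex d x → (j , l) ≡ x
    injective c eq with refl , refl ← scalᴹ-Aₜ-injective d (Coeff⇒≢0 c) eq = refl

  multiples-separated : ∀ {k l js v} → Coeff n l → All (Separated d k) js → ⋃S-tc1 d n js v →
    vertex d (k , l) ≢ v × ¬ Adjᵘⁿ d (vertex d (k , l)) v
  multiples-separated c sep (j , j∈js , l' , 1≤l' , l'≤n , refl)
    with k≢j , kj-apart , jk-apart ← All.lookup sep j∈js
    = (λ eq → k≢j (proj₂ (scalᴹ-Aₜ-injective d (Coeff⇒≢0 c) eq)))
    , scalᴹ-nonadjacent d (Coeff⇒≢0 c) (Coeff⇒≢0 (1≤l' , l'≤n)) kj-apart jk-apart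

-- The units of a block inj₁ k share the 2n cliques {l·Aⱼ : j in the block}, one for each
-- coefficient l; a block inj₂ k is a single clique containing all multiples of its units.
Joinable : ∀ d {b c} → Fin b ⊎ Fin c → 𝓞 d → 𝓞 d → Set
Joinable d (inj₁ _) j j' = j ≡ j' ⊎ Annihilates d j j' ⊎ Annihilates d j' j
Joinable d (inj₂ _) j j' = Annihilates d j j' ⊎ Annihilates d j' j

ValidBlocks : ∀ d (js : List (𝓞 d)) {b c} → (Fin (length js) → Fin b ⊎ Fin c) → Set
ValidBlocks d js block = ∀ i i' → block i ≡ block i' → Joinable d (block i) (lookup js i) (lookup js i')

encodeBlock : ∀ {b m c} → (Fin b × Fin m) ⊎ Fin c → Fin (b * m + c)
encodeBlock {b} {m} {c} = Fin.join (b * m) c ∘ Sum.map₁ (uncurry combine)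

encodeBlock-injective : ∀ {b m c} (x y : (Fin b × Fin m) ⊎ Fin c) → encodeBlock x ≡ encodeBlock y → x ≡ y
encodeBlock-injective {b} {m} {c} x y eq = unpair x y
  (trans (sym (Fin.splitAt-join (b * m) c _)) (trans (cong (splitAt (b * m)) eq) (Fin.splitAt-join (b * m) c _)))
  where
  unpair : ∀ (x y : (Fin b × Fin m) ⊎ Fin c) → Sum.map₁ (uncurry combine) x ≡ Sum.map₁ (uncurry combine) y → x ≡ y
  unpair (inj₁ (k , i)) (inj₁ (k' , i')) eq
    with refl , refl ← Fin.combine-injective k i k' i' (Sum.inj₁-injective eq) = refl
  unpair (inj₂ k)       (inj₂ k')        eq = cong inj₂ (Sum.inj₂-injective eq)
  unpair (inj₁ _)       (inj₂ _)         ()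
  unpair (inj₂ _)       (inj₁ _)         ()

module _ (d n : ℕ) {js : List (𝓞 d)} {b c} (block : Fin (length js) → Fin b ⊎ Fin c)
         (valid : ValidBlocks d js block) where

  blockTag : ∀ {v} → ⋃S-tc1 d n js v → (Fin b × Fin (2 * n)) ⊎ Fin c
  blockTag (_ , j∈js , l , 1≤l , l≤n , _) = Sum.map₁ (_, coeffIndex l (1≤l , l≤n)) (block (index j∈js))

  joinable : ∀ {j j'} (p : j ∈ js) (p' : j' ∈ js) → block (index p) ≡ block (index p') →
    Joinable d (block (index p)) j j'
  joinable p p' eq = subst₂ (Joinable d _) (sym (lookup-index p)) (sym (lookup-index p')) (valid _ _ eq)

  blockTag-same : ∀ {v w} (p : ⋃S-tc1 d n js v) (q : ⋃S-tc1 d n js w) → blockTag p ≡ blockTag q →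
    v ≡ w ⊎ Adjᵘⁿ d v w
  blockTag-same (j , j∈ , l , 1≤l , l≤n , refl) (j' , j'∈ , l' , 1≤l' , l'≤n , refl) eq
    with block (index j∈) | block (index j'∈) | joinable j∈ j'∈
  ... | inj₁ k | inj₁ k' | join
    with refl , same-index ← ×.,-injective (Sum.inj₁-injective eq)
    with refl ← coeffIndex-injective {l = l} {l'} (1≤l , l≤n) (1≤l' , l'≤n) same-index
    with join refl
  ... | inj₁ refl = inj₁ refl
  ... | inj₂ ann  = annihilates⇒≡⊎Adjᵘⁿ d ann l l
  blockTag-same _ _ eq | inj₂ k | inj₂ k' | join with refl ← Sum.inj₂-injective eq =
    annihilates⇒≡⊎Adjᵘⁿ d (join refl) _ _
  blockTag-same _ _ () | inj₁ _ | inj₂ _ | _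
  blockTag-same _ _ () | inj₂ _ | inj₁ _ | _

  blockCover : CliqueCover (⋃S-tc1 d n js) (Adjᵘⁿ d) (b * (2 * n) + c)
  blockCover = record
    { class      = encodeBlock ∘ blockTag
    ; same-class = λ p q eq → blockTag-same p q (encodeBlock-injective _ _ eq) }

annihilates? : ∀ d j j' → Dec (Annihilates d j j')
annihilates? d j j' = mulᴹ d (Aₜ d j) (Aₜ d j') ≟ᴹ 0ᴹ d

apart? : ∀ d j j' → Dec (Apart d j j')
apart? d j j' = ¬? (m₁₁ (mulᴹ d (Aₜ d j) (Aₜ d j')) ≟ᴿ 0ᴿ d)

separated? : ∀ d k j → Dec (Separated d k j)
separated? d k j = ¬? (k ≟ᴿ j) ×-dec apart? d k j ×-dec apart? d j k

pairwiseApart? : ∀ d js → Dec (PairwiseApart d js)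
pairwiseApart? d js = All.all? (λ j → All.all? (apart? d j) js) js

joinable? : ∀ d {b c} (β : Fin b ⊎ Fin c) j j' → Dec (Joinable d β j j')
joinable? d (inj₁ _) j j' = j ≟ᴿ j' ⊎-dec annihilates? d j j' ⊎-dec annihilates? d j' j
joinable? d (inj₂ _) j j' = annihilates? d j j' ⊎-dec annihilates? d j' j

validBlocks? : ∀ d js {b c} (block : Fin (length js) → Fin b ⊎ Fin c) → Dec (ValidBlocks d js block)
validBlocks? d js block = Fin.all? λ i → Fin.all? λ i' →
  Sum.≡-dec Fin._≟_ Fin._≟_ (block i) (block i') →-dec joinable? d (block i) (lookup js i) (lookup js i')

E₂₂ : ∀ d → M₂ d
E₂₂ d = mat (0ᴿ d) (0ᴿ d) (0ᴿ d) (ι d (+ 1))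

scalᴹ-E₂₂ : ∀ d l → mat (0ᴿ d) (0ᴿ d) (0ᴿ d) (ι d l) ≡ scalᴹ d (ι d l) (E₂₂ d)
scalᴹ-E₂₂ d l rewrite mulᴿ-ι-zeroʳ d l | mulᴿ-ι-identityʳ d l = refl

A₀E₂₂≡0 : ∀ d → mulᴹ d (Aₜ d (0ᴿ d)) (E₂₂ d) ≡ 0ᴹ d
A₀E₂₂≡0 zero    = refl
A₀E₂₂≡0 (suc d) = refl

A₀-apart : ∀ d → Apart d (0ᴿ d) (0ᴿ d)
A₀-apart zero    ()
A₀-apart (suc d) ()

module _ (d n : ℕ) where

  Γ₁-cover : CliqueCover (V-Γ₁ d n) (Adjᵘⁿ d) (2 * n)
  Γ₁-cover = record { class = coefficientClass ; same-class = same }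
    where
    coefficientClass : ∀ {v} → V-Γ₁ d n v → Fin (2 * n)
    coefficientClass (inj₁ (l , 1≤l , l≤n , _)) = coeffIndex l (1≤l , l≤n)
    coefficientClass (inj₂ (l , 1≤l , l≤n , _)) = coeffIndex l (1≤l , l≤n)

    A₀E₂₂-multiples : ∀ l l' → mulᴹ d (vertex d (0ᴿ d , l)) (mat (0ᴿ d) (0ᴿ d) (0ᴿ d) (ι d l')) ≡ 0ᴹ d
    A₀E₂₂-multiples l l' = subst (λ w → mulᴹ d (vertex d (0ᴿ d , l)) w ≡ 0ᴹ d) (sym (scalᴹ-E₂₂ d l'))
                                 (scalᴹ-zero-product d l l' (A₀E₂₂≡0 d))

    same : ∀ {v w} (p : V-Γ₁ d n v) (q : V-Γ₁ d n w) → coefficientClass p ≡ coefficientClass q →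
      v ≡ w ⊎ Adjᵘⁿ d v w
    same (inj₁ (l , 1≤l , l≤n , refl)) (inj₁ (l' , 1≤l' , l'≤n , refl)) eq
      with refl ← coeffIndex-injective {l = l} {l'} (1≤l , l≤n) (1≤l' , l'≤n) eq = inj₁ refl
    same (inj₂ (l , 1≤l , l≤n , refl)) (inj₂ (l' , 1≤l' , l'≤n , refl)) eq
      with refl ← coeffIndex-injective {l = l} {l'} (1≤l , l≤n) (1≤l' , l'≤n) eq = inj₁ refl
    same (inj₁ (l , _ , _ , refl)) (inj₂ (l' , _ , _ , refl)) _ = zero-product⇒≡⊎Adjᵘⁿ d (inj₁ (A₀E₂₂-multiples l l'))
    same (inj₂ (l , _ , _ , refl)) (inj₁ (l' , _ , _ , refl)) _ = zero-product⇒≡⊎Adjᵘⁿ d (inj₂ (A₀E₂₂-multiples l' l))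

  Γ₁-independenceNumber : IndependenceNumber (V-Γ₁ d n) (Adjᵘⁿ d) (2 * n)
  Γ₁-independenceNumber = independenceNumber
    (IsIndependentSet-mono (λ { (_ , here refl , s) → inj₁ s ; (_ , there () , _) })
                           (multiples-independent d n ([] ∷ []) ((A₀-apart d ∷ []) ∷ [])))
    (trans (length-multiples d n (0ᴿ d ∷ [])) (ℕ.*-identityˡ (2 * n)))
    Γ₁-cover

A₋₁A₁≡0 : ∀ d → Annihilates d (ι d (- + 1)) (ι d (+ 1))
A₋₁A₁≡0 zero    = refl
A₋₁A₁≡0 (suc d) = refl

A₁-apart : ∀ d → Apart d (ι d (+ 1)) (ι d (+ 1))
A₁-apart zero    ()
A₁-apart (suc d) ()

U-generic : ∀ d → d ≢ 1 → d ≢ 3 → U d ≡ ι d (+ 1) ∷ ι d (- + 1) ∷ []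
U-generic 0 _ _ = refl
U-generic 1 d≢1 _ = ⊥-elim (d≢1 refl)
U-generic 2 _ _ = refl
U-generic 3 _ d≢3 = ⊥-elim (d≢3 refl)
U-generic (suc (suc (suc (suc _)))) _ _ = refl

±1-blocks : Fin 2 → Fin 1 ⊎ Fin 0
±1-blocks _ = inj₁ zero

±1-blocks-valid : ∀ d → ValidBlocks d (ι d (+ 1) ∷ ι d (- + 1) ∷ []) ±1-blocks
±1-blocks-valid d zero       zero       _ = inj₁ refl
±1-blocks-valid d (suc zero) (suc zero) _ = inj₁ refl
±1-blocks-valid d zero       (suc zero) _ = inj₂ (inj₂ (A₋₁A₁≡0 d))
±1-blocks-valid d (suc zero) zero       _ = inj₂ (inj₁ (A₋₁A₁≡0 d))

±1-independenceNumber : ∀ d n →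
  IndependenceNumber (⋃S-tc1 d n (ι d (+ 1) ∷ ι d (- + 1) ∷ [])) (Adjᵘⁿ d) (2 * n)
±1-independenceNumber d n = independenceNumber
  (IsIndependentSet-mono (⋃S-tc1-mono d n (here refl ∷ []))
                         (multiples-independent d n ([] ∷ []) ((A₁-apart d ∷ []) ∷ [])))
  (trans (length-multiples d n (ι d (+ 1) ∷ [])) (ℕ.*-identityˡ (2 * n)))
  (subst (CliqueCover _ _) (trans (ℕ.+-identityʳ _) (ℕ.*-identityˡ (2 * n)))
         (blockCover d n ±1-blocks (±1-blocks-valid d)))

-- The graph Γ₂ for d = 1: U 1 lists 1, -1, i, -i

gaussianBlocks : Fin 4 → Fin 2 ⊎ Fin 1
gaussianBlocks zero                   = inj₁ zero
gaussianBlocks (suc zero)             = inj₂ zero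
gaussianBlocks (suc (suc zero))       = inj₁ zero
gaussianBlocks (suc (suc (suc zero))) = inj₁ (suc zero)

gaussian-independenceNumber : ∀ n → 1 ≤ n → IndependenceNumber (V-Γ₂ 1 n) (Adjᵘⁿ 1) (4 * n + 1)
gaussian-independenceNumber n n≥1 = independenceNumber
  independent
  (trans (cong suc (length-multiples 1 n ±i)) (trans (ℕ.+-comm 1 _) size))
  (subst (CliqueCover _ _) size (blockCover 1 n gaussianBlocks (from-yes (validBlocks? 1 (U 1) gaussianBlocks))))
  where
  minusOne : 𝓞 1
  minusOne = (- + 1 , + 0)

  ±i : List (𝓞 1)
  ±i = (+ 0 , + 1) ∷ (+ 0 , - + 1) ∷ []

  ±i⊆U : All (_∈ U 1) ±i
  ±i⊆U = there (there (here refl)) ∷ there (there (there (here refl))) ∷ []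

  ±i-independent : IsIndependentSet (⋃S-tc1 1 n ±i) (Adjᵘⁿ 1) (multiples 1 n ±i)
  ±i-independent = multiples-independent 1 n (((λ ()) ∷ []) ∷ [] ∷ []) (from-yes (pairwiseApart? 1 ±i))

  independent : IsIndependentSet (V-Γ₂ 1 n) (Adjᵘⁿ 1) (vertex 1 (minusOne , + 1) ∷ multiples 1 n ±i)
  independent = IsIndependentSet-∷
    (minusOne , there (here refl) , + 1 , s≤s z≤n , n≥1 , refl)
    (All.map (multiples-separated 1 n {l = + 1} (s≤s z≤n , n≥1) (from-yes (All.all? (separated? 1 minusOne) ±i)))
             (members ±i-independent))
    (IsIndependentSet-mono (⋃S-tc1-mono 1 n ±i⊆U) ±i-independent)

  size : 2 * (2 * n) + 1 ≡ 4 * n + 1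
  size = cong (_+ 1) (sym (ℕ.*-assoc 2 2 n))

-- The graph Γ₂ for d = 3: U 3 lists 1, -1, ω, -ω, ω², -ω²

eisensteinBlocks : Fin 6 → Fin 3 ⊎ Fin 0
eisensteinBlocks zero                               = inj₁ zero
eisensteinBlocks (suc zero)                         = inj₁ zero
eisensteinBlocks (suc (suc zero))                   = inj₁ (suc zero)
eisensteinBlocks (suc (suc (suc zero)))             = inj₁ (suc zero)
eisensteinBlocks (suc (suc (suc (suc zero))))       = inj₁ (suc (suc zero))
eisensteinBlocks (suc (suc (suc (suc (suc zero))))) = inj₁ (suc (suc zero))

eisenstein-independenceNumber : ∀ n → IndependenceNumber (V-Γ₂ 3 n) (Adjᵘⁿ 3) (6 * n)
eisenstein-independenceNumber n = independenceNumber
  (IsIndependentSet-mono (⋃S-tc1-mono 3 n cubeRoots⊆U)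
                         (multiples-independent 3 n (((λ ()) ∷ (λ ()) ∷ []) ∷ ((λ ()) ∷ []) ∷ [] ∷ [])
                                                    (from-yes (pairwiseApart? 3 cubeRoots))))
  (trans (length-multiples 3 n cubeRoots) size)
  (subst (CliqueCover _ _) (trans (ℕ.+-identityʳ _) size)
         (blockCover 3 n eisensteinBlocks (from-yes (validBlocks? 3 (U 3) eisensteinBlocks))))
  where
  cubeRoots : List (𝓞 3)
  cubeRoots = (+ 1 , + 0) ∷ (- + 1 , + 1) ∷ (+ 0 , - + 1) ∷ []

  cubeRoots⊆U : All (_∈ U 3) cubeRoots
  cubeRoots⊆U = here refl ∷ there (there (here refl)) ∷ there (there (there (there (here refl)))) ∷ []

  size : 3 * (2 * n) ≡ 6 * n
  size = sym (ℕ.*-assoc 3 2 n)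

theorem3p21 : (d : ℕ) → Admissible d → (n : ℕ) → 1 ≤ n →
    IndependenceNumber (V-Γ₁ d n) (Adjᵘⁿ d) (2 * n)
    × (d ≢ 1 → d ≢ 3 → IndependenceNumber (V-Γ₂ d n) (Adjᵘⁿ d) (2 * n))
    × (d ≡ 1 → IndependenceNumber (V-Γ₂ d n) (Adjᵘⁿ d) (4 * n + 1))
    × (d ≡ 3 → IndependenceNumber (V-Γ₂ d n) (Adjᵘⁿ d) (6 * n))
theorem3p21 d _ n n≥1 =
    Γ₁-independenceNumber d n
  , (λ d≢1 d≢3 → subst (λ us → IndependenceNumber (⋃S-tc1 d n us) (Adjᵘⁿ d) (2 * n))
                       (sym (U-generic d d≢1 d≢3)) (±1-independenceNumber d n))
  , (λ { refl → gaussian-independenceNumber n n≥1 })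
  , (λ { refl → eisenstein-independenceNumber n })
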